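{- Every $3$-uniform bi-hypergraph with exactly $6$ vertices and at most $9$ edges is colorable. Consequently $\mathrm{low}(6,3)\ge 10$.
   Context: A bi-hypergraph is a pair $\mathcal{H}=(\mathcal{V},\mathcal{E})$ with $\mathcal{V}$ a finite set and $\mathcal{E}$ a Sperner family of subsets of $\mathcal{V}$ (edges); it is $r$-uniform if all edges have size $r$. A proper coloring is a map $f:\mathcal{V}\to\mathbb{N}$ with $1<|\{f(v):v\in e\}|<|e|$ for every edge $e$; $\mathcal{H}$ is colorable if such $f$ exists. A subhypergraph is $(\mathcal{V}',\mathcal{E}')$ with $\mathcal{V}'\subseteq\mathcal{V}$, $\mathcal{E}'\subseteq\mathcal{E}$; $\mathcal{H}$ is minimal uncolorable if it is uncolorable but every proper subhypergraph is colorable. $\mathrm{low}(n,r)$ is the minimum number of edges of a minimal uncolorable $r$-uniform bi-hypergraph with $n$ vertices ($\infty$ if none exists). -}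

module Defs where

open import Data.Nat using (ℕ; _<_; _≤_)
import Data.Nat as ℕ
open import Data.Fin using (Fin)
open import Data.Fin.Subset using (Subset; ⊤; ∣_∣) renaming (_⊆_ to _⊆ₛ_)
open import Data.Fin.Subset.Properties using (_∈?_)
open import Data.List using (List; length; filter; map; deduplicate; allFin)
open import Data.List.Relation.Unary.All using (All)
open import Data.List.Relation.Unary.Unique.Propositional using (Unique)
open import Data.List.Membership.Propositional using (_∈_)
open import Data.List.Relation.Binary.Sublist.Propositional using () renaming (_⊆_ to _⊑_)
open import Data.Product using (Σ; _×_)
open import Data.Sum using (_⊎_)
open import Relation.Binary.PropositionalEquality using (_≡_; _≢_)
open import Relation.Nullary using (¬_)

-- A (bi-)hypergraph on the vertex set Fin n (any finite vertex set of size n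
-- is isomorphic to Fin n): a duplicate-free list of edges, each a subset of
-- Fin n, forming a Sperner family.
record BiHypergraph (n : ℕ) : Set where
  field
    edges   : List (Subset n)
    unique  : Unique edges
    sperner : ∀ {e e'} → e ∈ edges → e' ∈ edges → e ⊆ₛ e' → e ≡ e'
open BiHypergraph public

numEdges : ∀ {n} → BiHypergraph n → ℕ
numEdges H = length (edges H)

Uniform : ∀ {n} → ℕ → BiHypergraph n → Set
Uniform r H = All (λ e → ∣ e ∣ ≡ r) (edges H)

elems : ∀ {n} → Subset n → List (Fin n)
elems e = filter (λ i → i ∈? e) (allFin _)

numColours : ∀ {n} → (Fin n → ℕ) → Subset n → ℕ
numColours f e = length (deduplicate ℕ._≟_ (map f (elems e)))

ProperOn : ∀ {n} → (Fin n → ℕ) → List (Subset n) → Set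
ProperOn f es = All (λ e → 1 < numColours f e × numColours f e < ∣ e ∣) es

ColourableEdges : ∀ {n} → List (Subset n) → Set
ColourableEdges {n} es = Σ (Fin n → ℕ) (λ f → ProperOn f es)

Colourable : ∀ {n} → BiHypergraph n → Set
Colourable H = ColourableEdges (edges H)

-- Colourability of (V', E') only depends on E' (the colouring may be
-- extended arbitrarily outside V'), so it is expressed via ColourableEdges E'.
record SubHypergraph {n} (H : BiHypergraph n) : Set where
  field
    verts  : Subset n
    sedges : List (Subset n)
    sub    : sedges ⊑ edges H
    inside : All (λ e → e ⊆ₛ verts) sedges
open SubHypergraph public

ProperSub : ∀ {n} {H : BiHypergraph n} → SubHypergraph H → Set
ProperSub {H = H} S = verts S ≢ ⊤ ⊎ length (sedges S) < numEdges H

MinimalUncolourable : ∀ {n} → BiHypergraph n → Set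
MinimalUncolourable H =
  ¬ Colourable H × (∀ (S : SubHypergraph H) → ProperSub S → ColourableEdges (sedges S))

-- The twenty triples of a 6-set fall into ten complementary pairs {T, ∁T}.
-- Colouring T with one colour and ∁T with another gives every triple other
-- than T and ∁T exactly two colours, i.e. colours it properly. A hypergraph
-- with at most nine edges misses some complementary pair entirely, and the
-- colouring by that pair is then proper.
module Submission where

open import Defs
open import Data.Bool using (true; false; if_then_else_)
import Data.Bool.Properties as Bool
open import Data.Empty using (⊥-elim)
open import Data.Fin using (Fin; zero; suc)
open import Data.Fin.Properties using (injective⇒≤)
open import Data.Fin.Subset using (Subset; ∁; ∣_∣)
open import Data.Fin.Subset.Properties using (anySubset?)
open import Data.List using (List; []; _∷_; map; length; lookup)
open import Data.List.Properties using (length-map)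
open import Data.List.Relation.Unary.All as All using (All; _∷_)
open import Data.List.Relation.Unary.All.Properties using (¬All⇒Any¬)
open import Data.List.Relation.Unary.AllPairs using (allPairs?; _∷_)
open import Data.List.Relation.Unary.Unique.Propositional using (Unique)
open import Data.List.Relation.Binary.Subset.Propositional using (_⊆_)
open import Data.List.Membership.Propositional using (_∈_; _∉_; find)
open import Data.List.Membership.Propositional.Properties using (∈-lookup; ∈-map⁺)
open import Data.List.Membership.Setoid.Properties using (index-injective)
open import Data.Nat as ℕ using (ℕ; _≤_; _<_; _<?_; _≤?_; s≤s)
open import Data.Nat.Properties using (≰⇒>; <⇒≱)
open import Data.Product using (∃; _×_; _,_)
open import Data.Vec as Vec using (_∷_; [])
open import Data.Vec.Properties using (≡-dec)
open import Relation.Binary using (DecidableEquality)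
open import Relation.Binary.PropositionalEquality
  using (_≡_; _≢_; refl; sym; cong; subst; setoid)
open import Relation.Nullary using (Dec; yes; no; ¬_)
open import Relation.Nullary.Decidable using (_×-dec_; ¬?; from-yes; decidable-stable)

module _ {A : Set} where

  lookup-injective : ∀ {xs : List A} → Unique xs →
                     ∀ {i j} → lookup xs i ≡ lookup xs j → i ≡ j
  lookup-injective {_ ∷ _} _          {zero}  {zero}  _  = refl
  lookup-injective {_ ∷ _} (x∉ ∷ _)   {zero}  {suc j} eq = ⊥-elim (All.lookup x∉ (∈-lookup j) eq)
  lookup-injective {_ ∷ _} (x∉ ∷ _)   {suc i} {zero}  eq = ⊥-elim (All.lookup x∉ (∈-lookup i) (sym eq))
  lookup-injective {_ ∷ _} (_ ∷ uniq) {suc i} {suc j} eq = cong suc (lookup-injective uniq eq)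

  unique-⊆⇒length-≤ : ∀ {xs ys : List A} → Unique xs → xs ⊆ ys → length xs ≤ length ys
  unique-⊆⇒length-≤ uniq xs⊆ys = injective⇒≤ λ eq →
    lookup-injective uniq
      (index-injective (setoid A) (xs⊆ys (∈-lookup _)) (xs⊆ys (∈-lookup _)) eq)

module _ {A : Set} (_≟_ : DecidableEquality A) where
  open import Data.List.Membership.DecPropositional _≟_ using (_∈?_)

  ∃-∉-shorter : ∀ {xs ys : List A} → Unique xs →
                length ys < length xs → ∃ λ x → x ∈ xs × x ∉ ys
  ∃-∉-shorter {xs} {ys} uniq ys<xs with All.all? (_∈? ys) xs
  ... | yes xs⊆ys = ⊥-elim (<⇒≱ ys<xs (unique-⊆⇒length-≤ uniq (All.lookup xs⊆ys)))
  ... | no xs⊈ys  = find (¬All⇒Any¬ (_∈? ys) xs xs⊈ys)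

_≟ₛ_ : ∀ {n} → DecidableEquality (Subset n)
_≟ₛ_ = ≡-dec Bool._≟_

canonical : ∀ {n} → Subset (ℕ.suc n) → Subset (ℕ.suc n)
canonical (true  ∷ e) = true ∷ e
canonical (false ∷ e) = ∁ (false ∷ e)

splitColouring : ∀ {n} → Subset n → Fin n → ℕ
splitColouring T v = if Vec.lookup T v then 0 else 1

ProperlyColours : ∀ {n} → (Fin n → ℕ) → Subset n → Set
ProperlyColours f e = 1 < numColours f e × numColours f e < ∣ e ∣

properlyColours? : ∀ {n} (f : Fin n → ℕ) e → Dec (ProperlyColours f e)
properlyColours? f e = (1 <? numColours f e) ×-dec (numColours f e <? ∣ e ∣)

-- The canonical representatives of the ten complementary pairs {T, ∁ T} of triples.
balancedSplits : List (Subset 6)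
balancedSplits =
  (true ∷ true  ∷ true  ∷ false ∷ false ∷ false ∷ []) ∷
  (true ∷ true  ∷ false ∷ true  ∷ false ∷ false ∷ []) ∷
  (true ∷ true  ∷ false ∷ false ∷ true  ∷ false ∷ []) ∷
  (true ∷ true  ∷ false ∷ false ∷ false ∷ true  ∷ []) ∷
  (true ∷ false ∷ true  ∷ true  ∷ false ∷ false ∷ []) ∷
  (true ∷ false ∷ true  ∷ false ∷ true  ∷ false ∷ []) ∷
  (true ∷ false ∷ true  ∷ false ∷ false ∷ true  ∷ []) ∷
  (true ∷ false ∷ false ∷ true  ∷ true  ∷ false ∷ []) ∷
  (true ∷ false ∷ false ∷ true  ∷ false ∷ true  ∷ []) ∷
  (true ∷ false ∷ false ∷ false ∷ true  ∷ true  ∷ []) ∷ []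

balancedSplits-unique : Unique balancedSplits
balancedSplits-unique = from-yes (allPairs? (λ S T → ¬? (S ≟ₛ T)) balancedSplits)

splitColouring-proper : ∀ {T} → T ∈ balancedSplits →
                        ∀ e → ∣ e ∣ ≡ 3 → canonical e ≢ T →
                        ProperlyColours (splitColouring T) e
splitColouring-proper {T} T∈ e ∣e∣≡3 canonical≢T =
  decidable-stable (properlyColours? (splitColouring T) e)
    (λ improper → All.lookup noCounterexample T∈ (e , ∣e∣≡3 , canonical≢T , improper))
  where
  Counterexample : Subset 6 → Subset 6 → Set
  Counterexample T e = ∣ e ∣ ≡ 3 × canonical e ≢ T × ¬ ProperlyColours (splitColouring T) e

  counterexample? : ∀ T e → Dec (Counterexample T e)
  counterexample? T e = (∣ e ∣ ℕ.≟ 3) ×-dec ¬? (canonical e ≟ₛ T)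
                        ×-dec ¬? (properlyColours? (splitColouring T) e)

  noCounterexample : All (λ T → ¬ ∃ (Counterexample T)) balancedSplits
  noCounterexample = from-yes (All.all? (λ T → ¬? (anySubset? (counterexample? T))) balancedSplits)

colourable-≤9 : ∀ (H : BiHypergraph 6) → Uniform 3 H → numEdges H ≤ 9 → Colourable H
colourable-≤9 H uniform ≤9
  with T , T∈ , T∉ ← ∃-∉-shorter _≟ₛ_ {ys = map canonical (edges H)} balancedSplits-unique
                                  (subst (_< 10) (sym (length-map canonical (edges H))) (s≤s ≤9))
  = splitColouring T , All.tabulate λ {e} e∈ →
      splitColouring-proper T∈ e (All.lookup uniform e∈)
        (λ canonical≡T → T∉ (subst (_∈ map canonical (edges H)) canonical≡T (∈-map⁺ canonical e∈)))

corollary2p4 : (∀ (H : BiHypergraph 6) → Uniform 3 H → numEdges H ≤ 9 → Colourable H)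
             × (∀ (H : BiHypergraph 6) → Uniform 3 H → MinimalUncolourable H → 10 ≤ numEdges H)
corollary2p4 = colourable-≤9 , atLeast10
  where
  atLeast10 : ∀ (H : BiHypergraph 6) → Uniform 3 H → MinimalUncolourable H → 10 ≤ numEdges H
  atLeast10 H uniform (uncolourable , _) with numEdges H ≤? 9
  ... | yes ≤9 = ⊥-elim (uncolourable (colourable-≤9 H uniform ≤9))
  ... | no ≰9  = ≰⇒> ≰9
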